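{- For all $a,b,c,c_0,c_\infty\in\mathbb{C}$ and all $n\ge0$: (i) for $0\le k\le n$, $E_{n,k}(a,b;c_0+a,c_\infty-a)=E_{n,k}+an\,(E_{n-1,k}-E_{n-1,k-1})$, where each $E$ on the right has parameters $(a,b;c_0,c_\infty)$; (ii) for $-1\le k\le n$, $E_{n,k}(a,b;c_0+b,-c_0)=E_{n,k+1}(a,b;c_0,b-c_0)+(-1)^k(c_0)^{\underline n,a}\binom{n+1}{k+1}$; (iii) for $-1\le k\le n$, $c_\infty\,E_{n,k}(a,b;b-a,c_\infty+a)=E_{n+1,k+1}(a,b;0,c_\infty)$; (iv) for $0\le k\le n$, $c_0\,E_{n,k}(a,b;c_0-a,a+b)=E_{n+1,k}(a,b;c_0,0)$; (v) for $-1\le k\le n$, $c\,[E_{n,k+1}(a,b;c-a,a-c)-E_{n,k}(a,b;c-a,a-c)]=E_{n+1,k+1}(a,b;c,-c)$.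
   Context: For complex parameters $(\alpha,\beta,\gamma;\alpha',\beta',\gamma')$, the GKP triangle is the unique array $T_{n,k}$, $0\le k\le n$, with $T_{0,0}=1$ and $T_{n+1,k+1}=[\alpha n+\beta(k+1)+\gamma]T_{n,k+1}+[\alpha' n+\beta' k+\gamma']T_{n,k}$ for $n\ge0$, $k\ge-1$, entries outside $0\le k\le n$ being $0$. The generalized Eulerian numbers $E_{n,k}(a,b;c_0,c_\infty)$ form the GKP triangle with parameters $(-a,b,c_0;\,a+b,-b,c_\infty)$; by convention $E_{n,k}=0$ if $k<0$, $k>n$, or $n<0$. $(x)^{\underline m,a}=x(x-a)\cdots(x-(m-1)a)$, equal to $1$ for $m=0$. -}

module Defs where

open import Level using (Level)
open import Algebra.Bundles using (CommutativeRing)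
open import Data.Nat as ℕ using (ℕ; zero; suc)
open import Data.Nat.Combinatorics using (_C_)
open import Data.Integer as ℤ using (ℤ; +_; -[1+_])
open import Data.Integer.Base using (∣_∣)
open import Data.Bool using (if_then_else_)
open import Relation.Nullary.Decidable using (⌊_⌋)

-- All notions are developed over an arbitrary commutative ring R
-- (the paper works over ℂ).
module GE {c ℓ : Level} (R : CommutativeRing c ℓ) where
  open CommutativeRing R

  _-R_ : Carrier → Carrier → Carrier
  x -R y = x + (- y)

  ιℕ : ℕ → Carrier
  ιℕ zero    = 0#
  ιℕ (suc n) = 1# + ιℕ n

  ιℤ : ℤ → Carrier
  ιℤ (+ n)     = ιℕ n
  ιℤ -[1+ n ]  = - ιℕ (suc n)

  -- T_{0,k} = [k = 0];
  -- T_{n+1,k} = [α n + β k + γ] T_{n,k} + [α' n + β' (k-1) + γ'] T_{n,k-1}.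
  -- (This is the recurrence T_{n+1,k+1} = [αn+β(k+1)+γ]T_{n,k+1} + [α'n+β'k+γ']T_{n,k}
  --  applied for every integer k; all entries outside 0 ≤ k ≤ n are then 0.)
  GKP : (α β γ α' β' γ' : Carrier) → ℕ → ℤ → Carrier
  GKP α β γ α' β' γ' zero k =
    if ⌊ k ℤ.≟ + 0 ⌋ then 1# else 0#
  GKP α β γ α' β' γ' (suc n) k =
      (α * ιℕ n + β * ιℤ k + γ) * GKP α β γ α' β' γ' n k
    + (α' * ιℕ n + β' * ιℤ (k ℤ.- + 1) + γ') * GKP α β γ α' β' γ' n (k ℤ.- + 1)

  E : (a b c₀ c∞ : Carrier) → ℕ → ℤ → Carrier
  E a b c₀ c∞ = GKP (- a) b c₀ (a + b) (- b) c∞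

  -- E_{n-1,k}(a,b;c₀,c∞) for n ∈ ℕ (equal to 0 when n = 0, since E vanishes for negative n)
  Eprev : (a b c₀ c∞ : Carrier) → ℕ → ℤ → Carrier
  Eprev a b c₀ c∞ zero    k = 0#
  Eprev a b c₀ c∞ (suc n) k = E a b c₀ c∞ n k

  fallingFactorial : Carrier → ℕ → Carrier → Carrier
  fallingFactorial x zero    a = 1#
  fallingFactorial x (suc m) a = fallingFactorial x m a * (x -R (ιℕ m * a))

  negOnePowℕ : ℕ → Carrier
  negOnePowℕ zero    = 1#
  negOnePowℕ (suc n) = - negOnePowℕ n

  negOnePow : ℤ → Carrier
  negOnePow k = negOnePowℕ ∣ k ∣

  -- binomial coefficient C(n, m) for m ∈ ℤ with m ≥ 0, as an element of R
  binom : ℕ → ℤ → Carrier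
  binom n m = ιℕ (n C ∣ m ∣)

{-# OPTIONS --safe #-}
module Submission where

open import Defs
open import Level using (Level)
open import Algebra.Bundles using (CommutativeRing)
open import Data.Nat using (ℕ; suc)
open import Data.Integer as ℤ using (ℤ; +_; -[1+_]; _≤_)
open import Data.Product using (_×_)

open import Data.Product using (_,_)
open import Data.Nat as ℕ using (zero)
import Data.Nat.Properties as ℕP
open import Data.Nat.Combinatorics using (_C_; nCk+nC[k+1]≡[n+1]C[k+1])
open import Data.Integer using (_⊖_; _◃_)
import Data.Integer.Properties as ℤP
import Data.Sign as Sign
open import Data.Bool using (if_then_else_)
open import Data.Maybe using (Maybe; just; nothing)
open import Relation.Nullary using (yes; no)
open import Relation.Nullary.Decidable using (⌊_⌋)
open import Relation.Binary.PropositionalEquality as ≡ using (_≡_)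
import Algebra.Solver.Ring
import Algebra.Solver.Ring.AlmostCommutativeRing as ACR

-- Every identity compares two families X(n,k), n ∈ ℕ, k ∈ ℤ, satisfying the same GKP recurrence
-- X(n+1,k) = [αn+βk+γ] X(n,k) + [α'n+β'(k-1)+γ'] X(n,k-1); such a family is determined by its row
-- n = 0. The recurrence is preserved by scaling and sums, and shifting n resp. k by one only adds
-- α, α' resp. β, β' to γ, γ'. When β' = -β it is also preserved by the column difference
-- X(n,k) - X(n,k-1), at the cost of adding β to γ'. This settles (iii)-(v). In (i) the coefficients
-- of the left side at row n+1 are those of this difference of E at row n, so E + a n ΔE_{n-1}
-- satisfies the same recurrence as the left side. In (ii) the correction term does so because of
-- the absorption identity (k+1)C(m,k+1) = (m-k)C(m,k).
-- The identities hold for every k ∈ ℤ; only in (ii) is k ≥ -1 needed, for binom to agree with the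
-- Pascal triangle.

module IntegerCoefficients {c ℓ : Level} (R : CommutativeRing c ℓ) where
  open CommutativeRing R hiding (zero)
  open import Algebra.Properties.Ring ring using (-0#≈0#; -‿involutive; -‿distribˡ-*; -‿distribʳ-*; -‿+-comm)
  open import Algebra.Properties.Semiring.Mult.TCOptimised semiring using (1+×; ×-homo-+; ×1-homo-*) renaming (_×_ to _·_)
  open import Relation.Binary.Reasoning.Setoid setoid

  -- Coefficients are read through the optimised multiplication (rather than ιℤ), so that
  -- con (+ 0) and con (+ 1) denote 0# and 1# definitionally.
  private
    ⟦_⟧ℤ : ℤ → Carrier
    ⟦ + n ⟧ℤ      = n · 1#
    ⟦ -[1+ n ] ⟧ℤ = - (suc n · 1#)

    [1+x]-[1+y]≈x-y : ∀ x y → (1# + x) - (1# + y) ≈ x - y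
    [1+x]-[1+y]≈x-y x y = begin
      (1# + x) + - (1# + y)   ≈⟨ +-congˡ (-‿+-comm 1# y) ⟨
      (1# + x) + (- 1# + - y) ≈⟨ +-congʳ (+-comm 1# x) ⟩
      (x + 1#) + (- 1# + - y) ≈⟨ +-assoc x 1# _ ⟩
      x + (1# + (- 1# + - y)) ≈⟨ +-congˡ (+-assoc 1# (- 1#) (- y)) ⟨
      x + ((1# + - 1#) + - y) ≈⟨ +-congˡ (+-congʳ (-‿inverseʳ 1#)) ⟩
      x + (0# + - y)          ≈⟨ +-congˡ (+-identityˡ (- y)) ⟩
      x + - y                 ∎

    ⊖-homo : ∀ m n → ⟦ m ⊖ n ⟧ℤ ≈ m · 1# - n · 1#
    ⊖-homo m       zero    = sym (trans (+-congˡ -0#≈0#) (+-identityʳ _))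
    ⊖-homo zero    (suc n) = sym (+-identityˡ _)
    ⊖-homo (suc m) (suc n) = begin
      ⟦ suc m ⊖ suc n ⟧ℤ          ≡⟨ ≡.cong ⟦_⟧ℤ (ℤP.[1+m]⊖[1+n]≡m⊖n m n) ⟩
      ⟦ m ⊖ n ⟧ℤ                  ≈⟨ ⊖-homo m n ⟩
      m · 1# - n · 1#             ≈⟨ [1+x]-[1+y]≈x-y _ _ ⟨
      (1# + m · 1#) - (1# + n · 1#) ≈⟨ +-cong (1+× m 1#) (-‿cong (1+× n 1#)) ⟨
      suc m · 1# - suc n · 1#     ∎

    +◃-homo : ∀ n → ⟦ Sign.+ ◃ n ⟧ℤ ≈ n · 1#
    +◃-homo zero    = refl
    +◃-homo (suc n) = refl

    -◃-homo : ∀ n → ⟦ Sign.- ◃ n ⟧ℤ ≈ - (n · 1#)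
    -◃-homo zero    = sym -0#≈0#
    -◃-homo (suc n) = refl

    -x*-y≈x*y : ∀ x y → - x * - y ≈ x * y
    -x*-y≈x*y x y = begin
      - x * - y     ≈⟨ -‿distribˡ-* x (- y) ⟨
      - (x * - y)   ≈⟨ -‿cong (-‿distribʳ-* x y) ⟨
      - - (x * y)   ≈⟨ -‿involutive _ ⟩
      x * y         ∎

    +-homo : ∀ i j → ⟦ i ℤ.+ j ⟧ℤ ≈ ⟦ i ⟧ℤ + ⟦ j ⟧ℤ
    +-homo (+ m)    (+ n)    = ×-homo-+ 1# m n
    +-homo (+ m)    -[1+ n ] = ⊖-homo m (suc n)
    +-homo -[1+ m ] (+ n)    = trans (⊖-homo n (suc m)) (+-comm _ _)
    +-homo -[1+ m ] -[1+ n ] = begin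
      - (suc (suc (m ℕ.+ n)) · 1#)     ≡⟨ ≡.cong (λ k → - (suc k · 1#)) (ℕP.+-suc m n) ⟨
      - ((suc m ℕ.+ suc n) · 1#)       ≈⟨ -‿cong (×-homo-+ 1# (suc m) (suc n)) ⟩
      - (suc m · 1# + suc n · 1#)      ≈⟨ -‿+-comm _ _ ⟨
      - (suc m · 1#) + - (suc n · 1#)  ∎

    *-homo : ∀ i j → ⟦ i ℤ.* j ⟧ℤ ≈ ⟦ i ⟧ℤ * ⟦ j ⟧ℤ
    *-homo (+ m)    (+ n)    = trans (+◃-homo (m ℕ.* n)) (×1-homo-* m n)
    *-homo (+ m)    -[1+ n ] = trans (-◃-homo (m ℕ.* suc n))
                                 (trans (-‿cong (×1-homo-* m (suc n))) (-‿distribʳ-* _ _))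
    *-homo -[1+ m ] (+ n)    = trans (-◃-homo (suc m ℕ.* n))
                                 (trans (-‿cong (×1-homo-* (suc m) n)) (-‿distribˡ-* _ _))
    *-homo -[1+ m ] -[1+ n ] = trans (+◃-homo (suc m ℕ.* suc n))
                                 (trans (×1-homo-* (suc m) (suc n)) (sym (-x*-y≈x*y _ _)))

    -‿homo : ∀ i → ⟦ ℤ.- i ⟧ℤ ≈ - ⟦ i ⟧ℤ
    -‿homo (+ zero)  = sym -0#≈0#
    -‿homo (+ suc n) = refl
    -‿homo -[1+ n ]  = sym (-‿involutive _)

    homomorphism : ℤ.+-*-rawRing ACR.-Raw-AlmostCommutative⟶ ACR.fromCommutativeRing R
    homomorphism = record
      { ⟦_⟧ = ⟦_⟧ℤ ; +-homo = +-homo ; *-homo = *-homo ; -‿homo = -‿homo ; 0-homo = refl ; 1-homo = refl }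

    _≟ℤ_ : ∀ i j → Maybe (⟦ i ⟧ℤ ≈ ⟦ j ⟧ℤ)
    i ≟ℤ j with i ℤ.≟ j
    ... | yes ≡.refl = just refl
    ... | no _       = nothing

  open Algebra.Solver.Ring ℤ.+-*-rawRing (ACR.fromCommutativeRing R) homomorphism _≟ℤ_ public

  :0 :1 : ∀ {n} → Polynomial n
  :0 = con (+ 0)
  :1 = con (+ 1)

[k+1]-1≡k : ∀ k → (k ℤ.+ + 1) ℤ.- + 1 ≡ k
[k+1]-1≡k k = ≡.trans (ℤP.+-assoc k (+ 1) -[1+ 0 ]) (ℤP.+-identityʳ k)

[k-1]+1≡k : ∀ k → (k ℤ.- + 1) ℤ.+ + 1 ≡ k
[k-1]+1≡k k = ≡.trans (ℤP.+-assoc k -[1+ 0 ] (+ 1)) (ℤP.+-identityʳ k)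

module _ {c ℓ : Level} (R : CommutativeRing c ℓ) where
  open CommutativeRing R hiding (zero)
  open GE R
  open IntegerCoefficients R using (solve; _:=_; :0; :1; _:+_; _:-_; _:*_; :-_)
  open import Algebra.Properties.Ring ring using (-0#≈0#; -‿involutive)
  open import Relation.Binary.Reasoning.Setoid setoid

  ιℕ-+ : ∀ m n → ιℕ (m ℕ.+ n) ≈ ιℕ m + ιℕ n
  ιℕ-+ zero    n = sym (+-identityˡ _)
  ιℕ-+ (suc m) n = trans (+-congˡ (ιℕ-+ m n)) (sym (+-assoc _ _ _))

  ιℤ-suc : ∀ k → ιℤ (k ℤ.+ + 1) ≈ ιℤ k + 1#
  ιℤ-suc (+ m)        = trans (ιℕ-+ m 1) (+-congˡ (+-identityʳ 1#))
  ιℤ-suc -[1+ zero ]  = solve 0 (:0 := :- (:1 :+ :0) :+ :1) refl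
  ιℤ-suc -[1+ suc m ] =
    solve 1 (λ x → :- (:1 :+ x) := :- (:1 :+ (:1 :+ x)) :+ :1) refl (ιℕ m)

  ιℤ-pred : ∀ k → ιℤ (k ℤ.- + 1) ≈ ιℤ k - 1#
  ιℤ-pred k = begin
    ιℤ (k ℤ.- + 1)                  ≈⟨ solve 1 (λ x → x := (x :+ :1) :- :1) refl _ ⟩
    (ιℤ (k ℤ.- + 1) + 1#) - 1#      ≈⟨ +-congʳ (ιℤ-suc (k ℤ.- + 1)) ⟨
    ιℤ ((k ℤ.- + 1) ℤ.+ + 1) - 1#   ≡⟨ ≡.cong (λ j → ιℤ j - 1#) ([k-1]+1≡k k) ⟩
    ιℤ k - 1#                       ∎

  δ : ℤ → Carrier
  δ k = if ⌊ k ℤ.≟ + 0 ⌋ then 1# else 0#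

  ιℤ*δ≈0 : ∀ k → ιℤ k * δ k ≈ 0#
  ιℤ*δ≈0 (+ zero)  = zeroˡ _
  ιℤ*δ≈0 (+ suc m) = zeroʳ _
  ιℤ*δ≈0 -[1+ m ]  = zeroʳ _

  SatisfiesGKP : (α β γ α' β' γ' : Carrier) → (ℕ → ℤ → Carrier) → Set ℓ
  SatisfiesGKP α β γ α' β' γ' X = ∀ n k →
    X (suc n) k ≈ (α * ιℕ n + β * ιℤ k + γ) * X n k
                + (α' * ιℕ n + β' * (ιℤ k - 1#) + γ') * X n (k ℤ.- + 1)

  GKP-satisfies : ∀ α β γ α' β' γ' → SatisfiesGKP α β γ α' β' γ' (GKP α β γ α' β' γ')
  GKP-satisfies α β γ α' β' γ' n k = +-congˡ (*-congʳ (+-congʳ (+-congˡ (*-congˡ (ιℤ-pred k)))))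

  GKP[1,k] : ∀ α β γ α' β' γ' k → GKP α β γ α' β' γ' 1 k ≈ γ * δ k + γ' * δ (k ℤ.- + 1)
  GKP[1,k] α β γ α' β' γ' k = begin
    (α * 0# + β * K + γ) * δ k + (α' * 0# + β' * K₋ + γ') * δ (k ℤ.- + 1)
      ≈⟨ solve 10 (λ α β γ α' β' γ' K K₋ D D₋ →
           (α :* :0 :+ β :* K :+ γ) :* D :+ (α' :* :0 :+ β' :* K₋ :+ γ') :* D₋
           := (γ :* D :+ γ' :* D₋) :+ (β :* (K :* D) :+ β' :* (K₋ :* D₋)))
         refl α β γ α' β' γ' K K₋ (δ k) (δ (k ℤ.- + 1)) ⟩
    (γ * δ k + γ' * δ (k ℤ.- + 1)) + (β * (K * δ k) + β' * (K₋ * δ (k ℤ.- + 1)))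
      ≈⟨ +-congˡ (+-cong (*-congˡ (ιℤ*δ≈0 k)) (*-congˡ (ιℤ*δ≈0 (k ℤ.- + 1)))) ⟩
    (γ * δ k + γ' * δ (k ℤ.- + 1)) + (β * 0# + β' * 0#)
      ≈⟨ solve 6 (λ β β' γ γ' D D₋ →
           (γ :* D :+ γ' :* D₋) :+ (β :* :0 :+ β' :* :0) := γ :* D :+ γ' :* D₋)
           refl β β' γ γ' (δ k) (δ (k ℤ.- + 1)) ⟩
    γ * δ k + γ' * δ (k ℤ.- + 1) ∎
    where
    K  = ιℤ k
    K₋ = ιℤ (k ℤ.- + 1)

  satisfiesGKP-unique : ∀ {α β γ α' β' γ' X Y} →
    SatisfiesGKP α β γ α' β' γ' X → SatisfiesGKP α β γ α' β' γ' Y →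
    (∀ k → X 0 k ≈ Y 0 k) → ∀ n k → X n k ≈ Y n k
  satisfiesGKP-unique sx sy x₀≈y₀ zero    k = x₀≈y₀ k
  satisfiesGKP-unique sx sy x₀≈y₀ (suc n) k =
    trans (sx n k) (trans (+-cong (*-congˡ (IH k)) (*-congˡ (IH (k ℤ.- + 1)))) (sym (sy n k)))
    where IH = satisfiesGKP-unique sx sy x₀≈y₀ n

  satisfiesGKP-cong : ∀ {α β γ₁ γ₂ α' β' γ₁' γ₂' X} → γ₁ ≈ γ₂ → γ₁' ≈ γ₂' →
    SatisfiesGKP α β γ₁ α' β' γ₁' X → SatisfiesGKP α β γ₂ α' β' γ₂' X
  satisfiesGKP-cong γ₁≈γ₂ γ₁'≈γ₂' sx n k =
    trans (sx n k) (+-cong (*-congʳ (+-congˡ γ₁≈γ₂)) (*-congʳ (+-congˡ γ₁'≈γ₂')))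

  satisfiesGKP-*ˡ : ∀ {α β γ α' β' γ' X} u → SatisfiesGKP α β γ α' β' γ' X →
    SatisfiesGKP α β γ α' β' γ' (λ n k → u * X n k)
  satisfiesGKP-*ˡ {X = X} u sx n k = trans (*-congˡ (sx n k))
    (solve 5 (λ u A B x y → u :* (A :* x :+ B :* y) := A :* (u :* x) :+ B :* (u :* y))
       refl u _ _ (X n k) (X n (k ℤ.- + 1)))

  satisfiesGKP-+ : ∀ {α β γ α' β' γ' X Y} →
    SatisfiesGKP α β γ α' β' γ' X → SatisfiesGKP α β γ α' β' γ' Y →
    SatisfiesGKP α β γ α' β' γ' (λ n k → X n k + Y n k)
  satisfiesGKP-+ {X = X} {Y} sx sy n k = trans (+-cong (sx n k) (sy n k))
    (solve 6 (λ A B x y x₋ y₋ → (A :* x :+ B :* x₋) :+ (A :* y :+ B :* y₋) := A :* (x :+ y) :+ B :* (x₋ :+ y₋))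
       refl _ _ (X n k) (Y n k) (X n (k ℤ.- + 1)) (Y n (k ℤ.- + 1)))

  satisfiesGKP-suc : ∀ {α β γ α' β' γ' X} → SatisfiesGKP α β γ α' β' γ' X →
    SatisfiesGKP α β (γ + α) α' β' (γ' + α') (λ n → X (suc n))
  satisfiesGKP-suc {α} {β} {γ} {α'} {β'} {γ'} sx n k =
    trans (sx (suc n) k) (+-cong (*-congʳ (next-row α (β * ιℤ k) γ)) (*-congʳ (next-row α' (β' * (ιℤ k - 1#)) γ')))
    where
    next-row : ∀ x y z → x * (1# + ιℕ n) + y + z ≈ x * ιℕ n + y + (z + x)
    next-row x y z = solve 4 (λ x y z N → x :* (:1 :+ N) :+ y :+ z := x :* N :+ y :+ (z :+ x)) refl x y z (ιℕ n)

  satisfiesGKP-+1 : ∀ {α β γ α' β' γ' X} → SatisfiesGKP α β γ α' β' γ' X →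
    SatisfiesGKP α β (γ + β) α' β' (γ' + β') (λ n k → X n (k ℤ.+ + 1))
  satisfiesGKP-+1 {α} {β} {γ} {α'} {β'} {γ'} {X} sx n k = begin
    X (suc n) (k ℤ.+ + 1)
      ≈⟨ sx n (k ℤ.+ + 1) ⟩
    A₊ * X n (k ℤ.+ + 1) + B₊ * X n ((k ℤ.+ + 1) ℤ.- + 1)
      ≡⟨ ≡.cong (λ j → A₊ * X n (k ℤ.+ + 1) + B₊ * X n j) ([k+1]-1≡k k) ⟩
    A₊ * X n (k ℤ.+ + 1) + B₊ * X n k
      ≈⟨ +-cong (*-congʳ A₊≈A) (*-congʳ B₊≈B) ⟩
    A * X n (k ℤ.+ + 1) + B * X n k
      ≡⟨ ≡.cong (λ j → A * X n (k ℤ.+ + 1) + B * X n j) ([k-1]+1≡k k) ⟨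
    A * X n (k ℤ.+ + 1) + B * X n ((k ℤ.- + 1) ℤ.+ + 1) ∎
    where
    N = ιℕ n
    K = ιℤ k
    A₊ = α * N + β * ιℤ (k ℤ.+ + 1) + γ
    B₊ = α' * N + β' * (ιℤ (k ℤ.+ + 1) - 1#) + γ'
    A = α * N + β * K + (γ + β)
    B = α' * N + β' * (K - 1#) + (γ' + β')
    A₊≈A : A₊ ≈ A
    A₊≈A = trans (+-congʳ (+-congˡ (*-congˡ (ιℤ-suc k))))
      (solve 5 (λ α β γ N K → α :* N :+ β :* (K :+ :1) :+ γ := α :* N :+ β :* K :+ (γ :+ β))
         refl α β γ N K)
    B₊≈B : B₊ ≈ B
    B₊≈B = trans (+-congʳ (+-congˡ (*-congˡ (+-congʳ (ιℤ-suc k)))))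
      (solve 5 (λ α β γ N K → α :* N :+ β :* ((K :+ :1) :- :1) :+ γ
                              := α :* N :+ β :* (K :- :1) :+ (γ :+ β))
         refl α' β' γ' N K)

  Δ : (ℕ → ℤ → Carrier) → ℕ → ℤ → Carrier
  Δ X n k = X n k - X n (k ℤ.- + 1)

  satisfiesGKP-Δ : ∀ {α β γ α' γ' X} → SatisfiesGKP α β γ α' (- β) γ' X →
    SatisfiesGKP α β γ α' (- β) (γ' + β) (Δ X)
  satisfiesGKP-Δ {α} {β} {γ} {α'} {γ'} {X} sx n k = begin
    X (suc n) k - X (suc n) (k ℤ.- + 1)
      ≈⟨ +-cong (sx n k) (-‿cong (sx n (k ℤ.- + 1))) ⟩
    ((α * N + β * K + γ) * x + (α' * N + - β * (K - 1#) + γ') * x₋)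
      - ((α * N + β * ιℤ (k ℤ.- + 1) + γ) * x₋ + (α' * N + - β * (ιℤ (k ℤ.- + 1) - 1#) + γ') * x₋₋)
      ≈⟨ +-congˡ (-‿cong (+-cong (*-congʳ (+-congʳ (+-congˡ (*-congˡ (ιℤ-pred k)))))
                                 (*-congʳ (+-congʳ (+-congˡ (*-congˡ (+-congʳ (ιℤ-pred k)))))))) ⟩
    ((α * N + β * K + γ) * x + (α' * N + - β * (K - 1#) + γ') * x₋)
      - ((α * N + β * (K - 1#) + γ) * x₋ + (α' * N + - β * ((K - 1#) - 1#) + γ') * x₋₋)
      ≈⟨ solve 10 (λ α β γ α' γ' N K x x₋ x₋₋ →
           ((α :* N :+ β :* K :+ γ) :* x :+ (α' :* N :+ :- β :* (K :- :1) :+ γ') :* x₋)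
             :- ((α :* N :+ β :* (K :- :1) :+ γ) :* x₋
                 :+ (α' :* N :+ :- β :* ((K :- :1) :- :1) :+ γ') :* x₋₋)
           := (α :* N :+ β :* K :+ γ) :* (x :- x₋)
              :+ (α' :* N :+ :- β :* (K :- :1) :+ (γ' :+ β)) :* (x₋ :- x₋₋))
         refl α β γ α' γ' N K x x₋ x₋₋ ⟩
    (α * N + β * K + γ) * (x - x₋) + (α' * N + - β * (K - 1#) + (γ' + β)) * (x₋ - x₋₋) ∎
    where
    N = ιℕ n
    K = ιℤ k
    x = X n k
    x₋ = X n (k ℤ.- + 1)
    x₋₋ = X n ((k ℤ.- + 1) ℤ.- + 1)

  E-satisfies : ∀ a b c₀ c∞ → SatisfiesGKP (- a) b c₀ (a + b) (- b) c∞ (E a b c₀ c∞)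
  E-satisfies a b c₀ c∞ = GKP-satisfies (- a) b c₀ (a + b) (- b) c∞

  E+aΔ-satisfies : ∀ a b c₀ c∞ → SatisfiesGKP (- a) b (c₀ + a) (a + b) (- b) (c∞ - a)
    (λ n k → E a b c₀ c∞ n k + (a * ιℕ n) * Δ (Eprev a b c₀ c∞) n k)
  E+aΔ-satisfies a b c₀ c∞ zero k = trans (+-congʳ (E-satisfies a b c₀ c∞ 0 k))
    (solve 7 (λ a b c₀ c∞ K x x₋ →
       ((:- a :* :0 :+ b :* K :+ c₀) :* x :+ ((a :+ b) :* :0 :+ :- b :* (K :- :1) :+ c∞) :* x₋)
         :+ (a :* (:1 :+ :0)) :* (x :- x₋)
       := (:- a :* :0 :+ b :* K :+ (c₀ :+ a))
            :* (x :+ (a :* :0) :* (:0 :- :0))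
          :+ ((a :+ b) :* :0 :+ :- b :* (K :- :1) :+ (c∞ :- a))
            :* (x₋ :+ (a :* :0) :* (:0 :- :0)))
       refl a b c₀ c∞ (ιℤ k) (E a b c₀ c∞ 0 k) (E a b c₀ c∞ 0 (k ℤ.- + 1)))
  E+aΔ-satisfies a b c₀ c∞ (suc m) k = begin
    E a b c₀ c∞ (suc (suc m)) k + (a * (1# + (1# + N))) * (x - x₋)
      ≈⟨ +-congʳ (E-satisfies a b c₀ c∞ (suc m) k) ⟩
    ((- a * (1# + N) + b * K + c₀) * x + ((a + b) * (1# + N) + - b * (K - 1#) + c∞) * x₋)
      + (a * (1# + (1# + N))) * (x - x₋)
      ≈⟨ solve 8 (λ a b c₀ c∞ N K x x₋ →
           ((:- a :* (:1 :+ N) :+ b :* K :+ c₀) :* x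
              :+ ((a :+ b) :* (:1 :+ N) :+ :- b :* (K :- :1) :+ c∞) :* x₋)
             :+ (a :* (:1 :+ (:1 :+ N))) :* (x :- x₋)
           := ((:- a :* (:1 :+ N) :+ b :* K :+ (c₀ :+ a)) :* x
               :+ ((a :+ b) :* (:1 :+ N) :+ :- b :* (K :- :1) :+ (c∞ :- a)) :* x₋)
              :+ (a :* (:1 :+ N)) :* (x :- x₋))
         refl a b c₀ c∞ N K x x₋ ⟩
    (A * x + B * x₋) + (a * (1# + N)) * Δ E₀ (suc m) k
      ≈⟨ +-congˡ (*-congˡ (satisfiesGKP-Δ (E-satisfies a b c₀ c∞) m k)) ⟩
    (A * x + B * x₋)
      + (a * (1# + N)) * ((- a * N + b * K + c₀) * d + ((a + b) * N + - b * (K - 1#) + (c∞ + b)) * d₋)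
      ≈⟨ solve 10 (λ a b c₀ c∞ N K x x₋ d d₋ →
           ((:- a :* (:1 :+ N) :+ b :* K :+ (c₀ :+ a)) :* x
              :+ ((a :+ b) :* (:1 :+ N) :+ :- b :* (K :- :1) :+ (c∞ :- a)) :* x₋)
             :+ (a :* (:1 :+ N))
                :* ((:- a :* N :+ b :* K :+ c₀) :* d :+ ((a :+ b) :* N :+ :- b :* (K :- :1) :+ (c∞ :+ b)) :* d₋)
           := (:- a :* (:1 :+ N) :+ b :* K :+ (c₀ :+ a)) :* (x :+ (a :* (:1 :+ N)) :* d)
              :+ ((a :+ b) :* (:1 :+ N) :+ :- b :* (K :- :1) :+ (c∞ :- a)) :* (x₋ :+ (a :* (:1 :+ N)) :* d₋))
         refl a b c₀ c∞ N K x x₋ d d₋ ⟩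
    A * (x + (a * (1# + N)) * d) + B * (x₋ + (a * (1# + N)) * d₋) ∎
    where
    E₀ = E a b c₀ c∞
    N = ιℕ m
    K = ιℤ k
    x = E₀ (suc m) k
    x₋ = E₀ (suc m) (k ℤ.- + 1)
    d = Δ E₀ m k
    d₋ = Δ E₀ m (k ℤ.- + 1)
    A = - a * (1# + N) + b * K + (c₀ + a)
    B = (a + b) * (1# + N) + - b * (K - 1#) + (c∞ - a)

  E[c₀+a,c∞-a] : ∀ a b c₀ c∞ n k →
    E a b (c₀ + a) (c∞ - a) n k ≈ E a b c₀ c∞ n k + (a * ιℕ n) * Δ (Eprev a b c₀ c∞) n k
  E[c₀+a,c∞-a] a b c₀ c∞ = satisfiesGKP-unique
    (E-satisfies a b (c₀ + a) (c∞ - a))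
    (E+aΔ-satisfies a b c₀ c∞)
    (λ k → solve 2 (λ a x → x := x :+ (a :* :0) :* (:0 :- :0)) refl a (δ k))

  -- Unlike binom, which reads its lower index through ∣_∣, this vanishes for negative k.
  pascal : ℕ → ℤ → Carrier
  pascal zero    k = δ k
  pascal (suc n) k = pascal n k + pascal n (k ℤ.- + 1)

  pascal-neg : ∀ n j → pascal n -[1+ j ] ≈ 0#
  pascal-neg zero    j = refl
  pascal-neg (suc n) j = trans (+-cong (pascal-neg n j) (pascal-neg n (suc (j ℕ.+ 0)))) (+-identityʳ 0#)

  pascal-+ : ∀ n j → pascal n (+ j) ≈ ιℕ (n C j)
  pascal-+ zero    zero    = sym (+-identityʳ 1#)
  pascal-+ zero    (suc j) = refl
  pascal-+ (suc n) zero    = trans (+-cong (pascal-+ n zero) (pascal-neg n 0)) (+-identityʳ _)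
  pascal-+ (suc n) (suc j) = begin
    pascal n (+ suc j) + pascal n (+ j)  ≈⟨ +-cong (pascal-+ n (suc j)) (pascal-+ n j) ⟩
    ιℕ (n C suc j) + ιℕ (n C j)          ≈⟨ +-comm _ _ ⟩
    ιℕ (n C j) + ιℕ (n C suc j)          ≈⟨ ιℕ-+ (n C j) (n C suc j) ⟨
    ιℕ (n C j ℕ.+ n C suc j)             ≡⟨ ≡.cong ιℕ (nCk+nC[k+1]≡[n+1]C[k+1] n j) ⟩
    ιℕ (suc n C suc j)                   ∎

  pascal≈binom : ∀ n k → -[1+ 0 ] ≤ k → pascal n (k ℤ.+ + 1) ≈ binom n (k ℤ.+ + 1)
  pascal≈binom n (+ m)        _          = pascal-+ n (m ℕ.+ 1)
  pascal≈binom n -[1+ zero ]  _          = pascal-+ n 0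
  pascal≈binom n -[1+ suc m ] (ℤ.-≤- ())

  pascal-absorb : ∀ M k → (ιℤ k + 1#) * pascal M (k ℤ.+ + 1) ≈ (ιℕ M - ιℤ k) * pascal M k
  pascal-absorb zero k = begin
    (ιℤ k + 1#) * δ (k ℤ.+ + 1)    ≈⟨ *-congʳ (ιℤ-suc k) ⟨
    ιℤ (k ℤ.+ + 1) * δ (k ℤ.+ + 1) ≈⟨ ιℤ*δ≈0 (k ℤ.+ + 1) ⟩
    0#                             ≈⟨ trans (-‿cong (ιℤ*δ≈0 k)) -0#≈0# ⟨
    - (ιℤ k * δ k)                 ≈⟨ solve 2 (λ K x → :- (K :* x) := (:0 :- K) :* x) refl (ιℤ k) (δ k) ⟩
    (0# - ιℤ k) * δ k              ∎
  pascal-absorb (suc M) k = begin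
    (K + 1#) * (P (k ℤ.+ + 1) + P ((k ℤ.+ + 1) ℤ.- + 1))
      ≡⟨ ≡.cong (λ j → (K + 1#) * (P (k ℤ.+ + 1) + P j)) ([k+1]-1≡k k) ⟩
    (K + 1#) * (P (k ℤ.+ + 1) + P k)
      ≈⟨ distribˡ (K + 1#) _ _ ⟩
    (K + 1#) * P (k ℤ.+ + 1) + (K + 1#) * P k
      ≈⟨ +-congʳ (pascal-absorb M k) ⟩
    (ιℕ M - K) * P k + (K + 1#) * P k
      ≈⟨ solve 3 (λ M K x → (M :- K) :* x :+ (K :+ :1) :* x := ((:1 :+ M) :- K) :* x :+ K :* x)
           refl (ιℕ M) K (P k) ⟩
    ((1# + ιℕ M) - K) * P k + K * P k
      ≈⟨ +-congˡ K*Pk≈ ⟩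
    ((1# + ιℕ M) - K) * P k + ((1# + ιℕ M) - K) * P (k ℤ.- + 1)
      ≈⟨ distribˡ _ _ _ ⟨
    ((1# + ιℕ M) - K) * (P k + P (k ℤ.- + 1)) ∎
    where
    K = ιℤ k
    P = pascal M
    K*Pk≈ : K * P k ≈ ((1# + ιℕ M) - K) * P (k ℤ.- + 1)
    K*Pk≈ = begin
      K * P k
        ≡⟨ ≡.cong (λ j → ιℤ j * P j) ([k-1]+1≡k k) ⟨
      ιℤ ((k ℤ.- + 1) ℤ.+ + 1) * P ((k ℤ.- + 1) ℤ.+ + 1)
        ≈⟨ *-congʳ (ιℤ-suc (k ℤ.- + 1)) ⟩
      (ιℤ (k ℤ.- + 1) + 1#) * P ((k ℤ.- + 1) ℤ.+ + 1)
        ≈⟨ pascal-absorb M (k ℤ.- + 1) ⟩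
      (ιℕ M - ιℤ (k ℤ.- + 1)) * P (k ℤ.- + 1)
        ≈⟨ *-congʳ (+-congˡ (-‿cong (ιℤ-pred k))) ⟩
      (ιℕ M - (K - 1#)) * P (k ℤ.- + 1)
        ≈⟨ solve 3 (λ M K x → (M :- (K :- :1)) :* x := ((:1 :+ M) :- K) :* x) refl (ιℕ M) K _ ⟩
      ((1# + ιℕ M) - K) * P (k ℤ.- + 1) ∎

  negOnePow-pred : ∀ k → negOnePow (k ℤ.- + 1) ≈ - negOnePow k
  negOnePow-pred (+ zero)  = refl
  negOnePow-pred (+ suc m) = sym (-‿involutive _)
  negOnePow-pred -[1+ m ]  = reflexive (≡.cong (λ j → - negOnePowℕ (suc j)) (ℕP.+-identityʳ m))

  correctionTerm : (a c₀ : Carrier) → ℕ → ℤ → Carrier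
  correctionTerm a c₀ n k = (negOnePow k * fallingFactorial c₀ n a) * pascal (suc n) (k ℤ.+ + 1)

  correctionTerm-satisfies : ∀ a b c₀ → SatisfiesGKP (- a) b (c₀ + b) (a + b) (- b) (- c₀) (correctionTerm a c₀)
  correctionTerm-satisfies a b c₀ n k = begin
    (s * (f * (c₀ - N * a))) * (P₁ + pascal (suc n) ((k ℤ.+ + 1) ℤ.- + 1))
      ≡⟨ ≡.cong (λ j → (s * (f * (c₀ - N * a))) * (P₁ + pascal (suc n) j)) ([k+1]-1≡k k) ⟩
    (s * (f * (c₀ - N * a))) * (P₁ + P₀)
      ≈⟨ solve 9 (λ a b c₀ N K s f P₁ P₀ →
           (s :* (f :* (c₀ :- N :* a))) :* (P₁ :+ P₀)
           := ((:- a :* N :+ b :* K :+ (c₀ :+ b)) :* ((s :* f) :* P₁)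
               :+ ((a :+ b) :* N :+ :- b :* (K :- :1) :+ :- c₀) :* ((:- s :* f) :* P₀))
              :+ ((s :* f) :* b) :* (((:1 :+ N) :- K) :* P₀ :- (K :+ :1) :* P₁))
         refl a b c₀ N K s f P₁ P₀ ⟩
    (A * ((s * f) * P₁) + B * ((- s * f) * P₀)) + ((s * f) * b) * (((1# + N) - K) * P₀ - (K + 1#) * P₁)
      ≈⟨ +-congˡ (*-congˡ (trans (+-congˡ (-‿cong (pascal-absorb (suc n) k))) (-‿inverseʳ _))) ⟩
    (A * ((s * f) * P₁) + B * ((- s * f) * P₀)) + ((s * f) * b) * 0#
      ≈⟨ trans (+-congˡ (zeroʳ _)) (+-identityʳ _) ⟩
    A * ((s * f) * P₁) + B * ((- s * f) * P₀)
      ≈⟨ +-congˡ (*-congˡ (*-congʳ (*-congʳ (negOnePow-pred k)))) ⟨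
    A * ((s * f) * P₁) + B * ((negOnePow (k ℤ.- + 1) * f) * P₀)
      ≡⟨ ≡.cong (λ j → A * ((s * f) * P₁) + B * ((negOnePow (k ℤ.- + 1) * f) * pascal (suc n) j)) ([k-1]+1≡k k) ⟨
    A * correctionTerm a c₀ n k + B * correctionTerm a c₀ n (k ℤ.- + 1) ∎
    where
    s = negOnePow k
    f = fallingFactorial c₀ n a
    N = ιℕ n
    K = ιℤ k
    P₁ = pascal (suc n) (k ℤ.+ + 1)
    P₀ = pascal (suc n) k
    A = - a * N + b * K + (c₀ + b)
    B = (a + b) * N + - b * (K - 1#) + - c₀

  E[c₀+b,-c₀] : ∀ a b c₀ n k →
    E a b (c₀ + b) (- c₀) n k ≈ E a b c₀ (b - c₀) n (k ℤ.+ + 1) + correctionTerm a c₀ n k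
  E[c₀+b,-c₀] a b c₀ = satisfiesGKP-unique
    (E-satisfies a b (c₀ + b) (- c₀))
    (satisfiesGKP-+
      (satisfiesGKP-cong refl (solve 2 (λ b c₀ → b :- c₀ :+ :- b := :- c₀) refl b c₀)
        (satisfiesGKP-+1 (E-satisfies a b c₀ (b - c₀))))
      (correctionTerm-satisfies a b c₀))
    (λ k → ≡.subst (λ j → δ k ≈ δ (k ℤ.+ + 1) + (negOnePow k * 1#) * (δ (k ℤ.+ + 1) + δ j))
             (≡.sym ([k+1]-1≡k k)) (initialRow k))
    where
    initialRow : ∀ k → δ k ≈ δ (k ℤ.+ + 1) + (negOnePow k * 1#) * (δ (k ℤ.+ + 1) + δ k)
    initialRow (+ zero)     = solve 0 (:1 := :0 :+ (:1 :* :1) :* (:0 :+ :1)) refl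
    initialRow (+ suc m)    = solve 1 (λ s → :0 := :0 :+ (s :* :1) :* (:0 :+ :0)) refl _
    initialRow -[1+ zero ]  = solve 0 (:0 := :1 :+ (:- :1 :* :1) :* (:1 :+ :0)) refl
    initialRow -[1+ suc m ] = solve 1 (λ s → :0 := :0 :+ (s :* :1) :* (:0 :+ :0)) refl _

  E[0,c∞] : ∀ a b c∞ n k → c∞ * E a b (b - a) (c∞ + a) n k ≈ E a b 0# c∞ (suc n) (k ℤ.+ + 1)
  E[0,c∞] a b c∞ = satisfiesGKP-unique
    (satisfiesGKP-*ˡ c∞ (E-satisfies a b (b - a) (c∞ + a)))
    (satisfiesGKP-cong
      (solve 2 (λ a b → :0 :+ b :- a := b :- a) refl a b)
      (solve 3 (λ a b c∞ → c∞ :- b :+ (a :+ b) := c∞ :+ a) refl a b c∞)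
      (satisfiesGKP-suc (satisfiesGKP-+1 (E-satisfies a b 0# c∞))))
    λ k → sym (trans (GKP[1,k] _ _ _ _ _ _ (k ℤ.+ + 1)) (begin
      0# * δ (k ℤ.+ + 1) + c∞ * δ ((k ℤ.+ + 1) ℤ.- + 1) ≡⟨ ≡.cong (λ j → 0# * δ (k ℤ.+ + 1) + c∞ * δ j) ([k+1]-1≡k k) ⟩
      0# * δ (k ℤ.+ + 1) + c∞ * δ k                     ≈⟨ trans (+-congʳ (zeroˡ _)) (+-identityˡ _) ⟩
      c∞ * δ k                                          ∎))

  E[c₀,0] : ∀ a b c₀ n k → c₀ * E a b (c₀ - a) (a + b) n k ≈ E a b c₀ 0# (suc n) k
  E[c₀,0] a b c₀ = satisfiesGKP-unique
    (satisfiesGKP-*ˡ c₀ (E-satisfies a b (c₀ - a) (a + b)))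
    (satisfiesGKP-cong refl (+-identityˡ (a + b)) (satisfiesGKP-suc (E-satisfies a b c₀ 0#)))
    (λ k → sym (trans (GKP[1,k] _ _ _ _ _ _ k) (trans (+-congˡ (zeroˡ _)) (+-identityʳ _))))

  E[c,-c] : ∀ a b c n k →
    c * (E a b (c - a) (a - c) n (k ℤ.+ + 1) - E a b (c - a) (a - c) n k) ≈ E a b c (- c) (suc n) (k ℤ.+ + 1)
  E[c,-c] a b c n k = begin
    c * (F n (k ℤ.+ + 1) - F n k)                      ≡⟨ ≡.cong (λ j → c * (F n (k ℤ.+ + 1) - F n j)) ([k+1]-1≡k k) ⟨
    c * Δ F n (k ℤ.+ + 1)                               ≈⟨ satisfiesGKP-unique
      (satisfiesGKP-*ˡ c (satisfiesGKP-+1 (satisfiesGKP-Δ (E-satisfies a b (c - a) (a - c)))))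
      (satisfiesGKP-cong
        (solve 3 (λ a b c → c :+ b :- a := c :- a :+ b) refl a b c)
        (solve 3 (λ a b c → :- c :- b :+ (a :+ b) := a :- c :+ b :- b) refl a b c)
        (satisfiesGKP-suc (satisfiesGKP-+1 (E-satisfies a b c (- c)))))
      (λ j → sym (trans (GKP[1,k] _ _ _ _ _ _ (j ℤ.+ + 1))
        (solve 3 (λ c x y → c :* x :+ :- c :* y := c :* (x :- y)) refl c _ _)))
      n k ⟩
    E a b c (- c) (suc n) (k ℤ.+ + 1)                   ∎
    where F = E a b (c - a) (a - c)

theorem4p17 : ∀ {c ℓ : Level} (R : CommutativeRing c ℓ) →
  let open CommutativeRing R
      open GE R
  in ∀ (a b cc c₀ c∞ : Carrier) (n : ℕ) →
    (∀ (k : ℤ) → + 0 ≤ k → k ≤ + n →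
       E a b (c₀ + a) (c∞ -R a) n k
         ≈ E a b c₀ c∞ n k
           + (a * ιℕ n) * (Eprev a b c₀ c∞ n k -R Eprev a b c₀ c∞ n (k ℤ.+ -[1+ 0 ])))
    × (∀ (k : ℤ) → -[1+ 0 ] ≤ k → k ≤ + n →
       E a b (c₀ + b) (- c₀) n k
         ≈ E a b c₀ (b -R c₀) n (k ℤ.+ + 1)
           + (negOnePow k * fallingFactorial c₀ n a) * binom (suc n) (k ℤ.+ + 1))
    × (∀ (k : ℤ) → -[1+ 0 ] ≤ k → k ≤ + n →
       c∞ * E a b (b -R a) (c∞ + a) n k ≈ E a b 0# c∞ (suc n) (k ℤ.+ + 1))
    × (∀ (k : ℤ) → + 0 ≤ k → k ≤ + n →
       c₀ * E a b (c₀ -R a) (a + b) n k ≈ E a b c₀ 0# (suc n) k)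
    × (∀ (k : ℤ) → -[1+ 0 ] ≤ k → k ≤ + n →
       cc * (E a b (cc -R a) (a -R cc) n (k ℤ.+ + 1) -R E a b (cc -R a) (a -R cc) n k)
         ≈ E a b cc (- cc) (suc n) (k ℤ.+ + 1))
theorem4p17 R a b cc c₀ c∞ n =
    (λ k _ _ → E[c₀+a,c∞-a] R a b c₀ c∞ n k)
  , (λ k -1≤k _ → trans (E[c₀+b,-c₀] R a b c₀ n k) (+-congˡ (*-congˡ (pascal≈binom R (suc n) k -1≤k))))
  , (λ k _ _ → E[0,c∞] R a b c∞ n k)
  , (λ k _ _ → E[c₀,0] R a b c₀ n k)
  , (λ k _ _ → E[c,-c] R a b cc n k)
  where open CommutativeRing R
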